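{- Let $B$ be a finite-dimensional $\mathbb{Q}$-algebra with a positive involution $*$, let $O$ be an order of $B$, let $V$ be a faithful finitely generated left $B$-module, and let $f:V\times V\to B$ be a positive-definite Hermitian form. Let $L$ be an $O$-lattice in $V$. Then every nonzero element $x\in L$ is a finite sum of primitive elements of $L$.
   Context: A positive involution on $B$ is a $\mathbb{Q}$-linear map $*$ with $(ab)^*=b^*a^*$, $(a^*)^*=a$, and $\mathrm{Tr}_{B/\mathbb{Q}}(bb^*)>0$ for every nonzero $b\in B$, where $\mathrm{Tr}_{B/\mathbb{Q}}(b)$ is the trace of left multiplication by $b$ on $B$. An order of $B$ is a subring finitely generated as a $\mathbb{Z}$-module and spanning $B$ over $\mathbb{Q}$. A Hermitian form is a $\mathbb{Q}$-bilinear $f:V\times V\to B$ with $f(ax,y)=af(x,y)$ and $f(y,x)=f(x,y)^*$ for $x,y\in V$, $a\in B$; it is positive definite if $\mathrm{Tr}_{B/\mathbb{Q}}\circ f$ is a positive-definite $\mathbb{Q}$-bilinear form on $V$. An $O$-lattice in $V$ is a finitely generated $\mathbb{Z}$-submodule of $V$ spanning $V$ over $\mathbb{Q}$ with $OL\subseteq L$. A nonzero $x\in L$ is primitive if whenever $x=y+z$ with $y,z\in L$ and $f(y,z)=0$, one has $y=0$ or $z=0$. -}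

module Defs where

-- A finite-dimensional ℚ-vector space of
-- dimension n is ℚ^n, represented as functions Fin n → ℚ.
-- A finite-dimensional ℚ-algebra B of dimension n is ℚ^n with a
-- ℚ-bilinear multiplication given by structure constants
-- (e_i e_j = Σ_k c i j k e_k), required to be associative and unital.
-- A finitely generated left B-module V is (as a ℚ-vector space) ℚ^m,
-- with ℚ-bilinear action given by structure constants.
-- A ℚ-bilinear form V × V → B is likewise given by structure constants.

open import Data.Nat using (ℕ; zero; suc)
open import Data.Fin using (Fin; zero; suc)
open import Data.Integer using (ℤ)
open import Data.Rational using (ℚ; 0ℚ; 1ℚ; _+_; _*_; _<_; _/_)
open import Data.Product using (Σ; _×_; _,_)
open import Data.Sum using (_⊎_)
open import Data.List using (List; []; _∷_)
open import Data.List.Relation.Unary.All using (All)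
open import Relation.Binary.PropositionalEquality using (_≡_)
open import Relation.Nullary using (¬_)

Vec : ℕ → Set
Vec n = Fin n → ℚ

∑ : ∀ {n} → (Fin n → ℚ) → ℚ
∑ {zero}  f = 0ℚ
∑ {suc n} f = f zero + ∑ (λ i → f (suc i))

infix 4 _≋_
_≋_ : ∀ {n} → Vec n → Vec n → Set
u ≋ v = ∀ i → u i ≡ v i

𝟎 : ∀ {n} → Vec n
𝟎 _ = 0ℚ

_⊕_ : ∀ {n} → Vec n → Vec n → Vec n
(u ⊕ v) i = u i + v i

_⊙_ : ∀ {n} → ℚ → Vec n → Vec n
(q ⊙ v) i = q * v i

NonZero : ∀ {n} → Vec n → Set
NonZero v = ¬ (v ≋ 𝟎)

sumV : ∀ {n} → List (Vec n) → Vec n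
sumV []       = 𝟎
sumV (v ∷ vs) = v ⊕ sumV vs

ℤcomb : ∀ {n r} → (Fin r → Vec n) → (Fin r → ℤ) → Vec n
ℤcomb g c k = ∑ (λ i → (c i / 1) * g i k)

ℚcomb : ∀ {n r} → (Fin r → Vec n) → (Fin r → ℚ) → Vec n
ℚcomb g q k = ∑ (λ i → q i * g i k)

InZSpan : ∀ {n r} → (Fin r → Vec n) → Vec n → Set
InZSpan g x = Σ (Fin _ → ℤ) λ c → x ≋ ℤcomb g c

SpansQ : ∀ {n r} → (Fin r → Vec n) → Set
SpansQ {n} g = ∀ (x : Vec n) → Σ (Fin _ → ℚ) λ q → x ≋ ℚcomb g q

record FDAlgebra (n : ℕ) : Set where
  field
    c   : Fin n → Fin n → Fin n → ℚ
    one : Vec n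

  mul : Vec n → Vec n → Vec n
  mul a b k = ∑ (λ i → ∑ (λ j → (a i * b j) * c i j k))

  field
    mul-assoc : ∀ a b d → mul (mul a b) d ≋ mul a (mul b d)
    one-left  : ∀ a → mul one a ≋ a
    one-right : ∀ a → mul a one ≋ a

  -- Tr_{B/ℚ}(b) = trace of left multiplication by b.
  -- L_b(e_i) = Σ_k (Σ_j b_j c j i k) e_k, so Tr = Σ_i Σ_j b_j c j i i.
  Tr : Vec n → ℚ
  Tr b = ∑ (λ i → ∑ (λ j → b j * c j i i))

open FDAlgebra public

record IsPositiveInvolution {n} (B : FDAlgebra n) (star : Vec n → Vec n) : Set where
  field
    additive    : ∀ a b → star (a ⊕ b) ≋ (star a ⊕ star b)
    homogeneous : ∀ (q : ℚ) a → star (q ⊙ a) ≋ (q ⊙ star a)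
    anti-mul    : ∀ a b → star (mul B a b) ≋ mul B (star b) (star a)
    involutive  : ∀ a → star (star a) ≋ a
    positive    : ∀ b → NonZero b → 0ℚ < Tr B (mul B b (star b))

record IsOrder {n r} (B : FDAlgebra n) (g : Fin r → Vec n) : Set where
  field
    one-mem : InZSpan g (one B)
    mul-mem : ∀ a b → InZSpan g a → InZSpan g b → InZSpan g (mul B a b)
    spans   : SpansQ g

record LeftModule {n} (B : FDAlgebra n) (m : ℕ) : Set where
  field
    d : Fin n → Fin m → Fin m → ℚ

  act : Vec n → Vec m → Vec m
  act a v k = ∑ (λ i → ∑ (λ j → (a i * v j) * d i j k))

  field
    act-assoc : ∀ a b v → act (mul B a b) v ≋ act a (act b v)
    act-one   : ∀ v → act (one B) v ≋ v

open LeftModule public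

Faithful : ∀ {n m} {B : FDAlgebra n} → LeftModule B m → Set
Faithful {n} {m} V = ∀ (a : Vec n) → (∀ (v : Vec m) → act V a v ≋ 𝟎) → a ≋ 𝟎

record BilinearForm (n m : ℕ) : Set where
  field
    h : Fin m → Fin m → Fin n → ℚ

  app : Vec m → Vec m → Vec n
  app x y k = ∑ (λ i → ∑ (λ j → (x i * y j) * h i j k))

open BilinearForm public

record IsPosDefHermitian {n m} (B : FDAlgebra n) (star : Vec n → Vec n)
       (V : LeftModule B m) (f : BilinearForm n m) : Set where
  field
    linear-left : ∀ a x y → app f (act V a x) y ≋ mul B a (app f x y)
    hermitian   : ∀ x y → app f y x ≋ star (app f x y)
    pos-def     : ∀ x → NonZero x → 0ℚ < Tr B (app f x x)

record IsOLattice {n m r s} (B : FDAlgebra n) (V : LeftModule B m)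
       (O : Fin r → Vec n) (L : Fin s → Vec m) : Set where
  field
    spans  : SpansQ L
    stable : ∀ a x → InZSpan O a → InZSpan L x → InZSpan L (act V a x)

Primitive : ∀ {n m s} → BilinearForm n m → (Fin s → Vec m) → Vec m → Set
Primitive f L x =
  InZSpan L x × NonZero x ×
  (∀ y z → InZSpan L y → InZSpan L z → x ≋ (y ⊕ z) → app f y z ≋ 𝟎 →
     (y ≋ 𝟎) ⊎ (z ≋ 𝟎))

module Submission where

-- Q(x) = Tr f(x, x) is a positive definite rational quadratic form, and a splitting
-- x = y + z with f(y, z) = 0 gives Q(x) = Q(y) + Q(z), because f(z, y) = f(y, z)* = 0.
-- So splitting off orthogonal summands lowers Q, and it must stop at primitive vectors
-- once Q takes only finitely many values on lattice vectors below a given level.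
-- That finiteness also makes primitivity decidable, which a constructive proof needs:
-- completing the square bounds the coordinates of every v with Q(v) ≤ T, and since
-- N ℤ^m ⊆ L for some N > 0 while D L ⊆ ℤ^m for some D > 0, the lattice vectors in such
-- a box lie in finitely many explicit cosets of N ℤ^m, which can be listed. The descent
-- is measured by the number of listed values of Q below Q(x).

open import Defs
open import Data.Empty using (⊥-elim)
open import Data.Fin using (Fin; zero; suc)
import Data.Fin.Properties as Fin
open import Data.Integer as ℤ using (ℤ; -[1+_])
import Data.Integer.DivMod as ℤ
import Data.Integer.Properties as ℤ
open import Data.List using (List; []; _∷_; [_]; map; concatMap; _++_; upTo)
open import Data.List.Membership.Propositional using (_∈_)
open import Data.List.Membership.Propositional.Properties using (∈-map⁺; ∈-++⁺ˡ; ∈-++⁺ʳ; ∈-upTo⁺)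
open import Data.List.Relation.Unary.All using (All; _∷_; [])
import Data.List.Relation.Unary.All.Properties as All
open import Data.List.Relation.Unary.Any as Any using (Any; here; there; any?)
import Data.List.Relation.Unary.Any.Properties as Any
open import Data.Nat as ℕ using (ℕ; zero; suc)
import Data.Nat.Properties as ℕ
open import Data.Product using (Σ; _×_; _,_; proj₁; proj₂)
open import Data.Rational as ℚ
  using (ℚ; 0ℚ; 1ℚ; _+_; _*_; _-_; -_; _<_; _≤_; _<?_; ∣_∣; _⊔_; 1/_; _/_; ↥_; ↧ₙ_; mkℚ; toℚᵘ; positive; nonNegative)
open import Data.Rational.Properties
import Data.Rational.Unnormalised as ℚᵘ
import Data.Rational.Unnormalised.Properties as ℚᵘ
open import Data.Sum using (_⊎_; inj₁; inj₂)
open import Data.Vec.Functional using (head; tail) renaming (_∷_ to _∷ᵥ_)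
open import Level using (0ℓ)
open import Relation.Binary.PropositionalEquality
  using (_≡_; refl; sym; trans; cong; cong₂; subst; subst₂; _≗_; module ≡-Reasoning)
open import Relation.Nullary using (¬_; Dec; yes; no)
open import Relation.Nullary.Decidable using (dec⇒maybe; ¬?; _×-dec_)
open import Tactic.RingSolver using (solve-∀)
open import Tactic.RingSolver.Core.AlmostCommutativeRing using (AlmostCommutativeRing; fromCommutativeRing)

ℚ-ring : AlmostCommutativeRing 0ℓ 0ℓ
ℚ-ring = fromCommutativeRing +-*-commutativeRing (λ x → dec⇒maybe (0ℚ ≟ x))

dec-≋𝟎 : ∀ {n} (u : Vec n) → Dec (u ≋ 𝟎)
dec-≋𝟎 u = Fin.all? (λ i → u i ≟ 0ℚ)

≤-of-+ˡ : ∀ {x y z} → x ≡ y + z → 0ℚ ≤ z → y ≤ x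
≤-of-+ˡ {y = y} x≡y+z 0≤z = subst₂ _≤_ (+-identityʳ y) (sym x≡y+z) (+-monoʳ-≤ y 0≤z)

≤-of-+ʳ : ∀ {x y z} → x ≡ y + z → 0ℚ ≤ y → z ≤ x
≤-of-+ʳ {y = y} {z} x≡y+z = ≤-of-+ˡ (trans x≡y+z (+-comm y z))

<-of-+ˡ : ∀ {x y z} → x ≡ y + z → 0ℚ < z → y < x
<-of-+ˡ {y = y} x≡y+z 0<z = subst₂ _<_ (+-identityʳ y) (sym x≡y+z) (+-monoʳ-< y 0<z)

*-nonNeg : ∀ {p q} → 0ℚ ≤ p → 0ℚ ≤ q → 0ℚ ≤ p * q
*-nonNeg {p} {q} 0≤p 0≤q =
  nonNegative⁻¹ (p * q) {{nonNeg*nonNeg⇒nonNeg p {{nonNegative 0≤p}} q {{nonNegative 0≤q}}}}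

p*p≡∣p∣*∣p∣ : ∀ p → p * p ≡ ∣ p ∣ * ∣ p ∣
p*p≡∣p∣*∣p∣ p with ∣p∣≡p∨∣p∣≡-p p
... | inj₁ ∣p∣≡p  = cong (λ q → q * q) (sym ∣p∣≡p)
... | inj₂ ∣p∣≡-p = trans (neg-square p) (cong (λ q → q * q) (sym ∣p∣≡-p))
  where
  neg-square : ∀ p → p * p ≡ (- p) * (- p)
  neg-square = solve-∀ ℚ-ring

p*p-nonNeg : ∀ p → 0ℚ ≤ p * p
p*p-nonNeg p = subst (0ℚ ≤_) (sym (p*p≡∣p∣*∣p∣ p)) (*-nonNeg (0≤∣p∣ p) (0≤∣p∣ p))

∣p∣≤1⊔p*p : ∀ p q → p * p ≤ q → ∣ p ∣ ≤ 1ℚ ⊔ q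
∣p∣≤1⊔p*p p q p*p≤q with ∣ p ∣ ≤? 1ℚ
... | yes ∣p∣≤1 = ≤-trans ∣p∣≤1 (p≤p⊔q 1ℚ q)
... | no  ∣p∣≰1 = ≤-trans ∣p∣≤∣p∣*∣p∣ (≤-trans (subst (_≤ q) (p*p≡∣p∣*∣p∣ p) p*p≤q) (p≤q⊔p 1ℚ q))
  where
  ∣p∣≤∣p∣*∣p∣ : ∣ p ∣ ≤ ∣ p ∣ * ∣ p ∣
  ∣p∣≤∣p∣*∣p∣ = subst (_≤ ∣ p ∣ * ∣ p ∣) (*-identityˡ ∣ p ∣)
    (*-monoʳ-≤-nonNeg ∣ p ∣ {{∣-∣-nonNeg p}} (<⇒≤ (≰⇒> ∣p∣≰1)))

p≤∣p∣ : ∀ p → p ≤ ∣ p ∣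
p≤∣p∣ p with ∣p∣≡p∨∣p∣≡-p p
... | inj₁ ∣p∣≡p  = ≤-reflexive (sym ∣p∣≡p)
... | inj₂ ∣p∣≡-p = ≤-trans p≤0 (0≤∣p∣ p)
  where
  neg-involutive : ∀ p → - - p ≡ p
  neg-involutive = solve-∀ ℚ-ring
  p≤0 : p ≤ 0ℚ
  p≤0 = subst (_≤ 0ℚ) (trans (cong -_ ∣p∣≡-p) (neg-involutive p)) (neg-antimono-≤ (0≤∣p∣ p))

∑-cong : ∀ {n} {f g : Fin n → ℚ} → (∀ i → f i ≡ g i) → ∑ f ≡ ∑ g
∑-cong {zero}  _ = refl
∑-cong {suc n} f≗g = cong₂ _+_ (f≗g zero) (∑-cong (λ i → f≗g (suc i)))

∑-zero : ∀ {n} {f : Fin n → ℚ} → (∀ i → f i ≡ 0ℚ) → ∑ f ≡ 0ℚ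
∑-zero {zero}  _ = refl
∑-zero {suc n} f≗0 = cong₂ _+_ (f≗0 zero) (∑-zero (λ i → f≗0 (suc i)))

∑-distrib-+ : ∀ {n} (f g : Fin n → ℚ) → ∑ (λ i → f i + g i) ≡ ∑ f + ∑ g
∑-distrib-+ {zero}  _ _ = refl
∑-distrib-+ {suc n} f g = begin
  (f zero + g zero) + ∑ (λ i → f (suc i) + g (suc i))
    ≡⟨ cong ((f zero + g zero) +_) (∑-distrib-+ (λ i → f (suc i)) (λ i → g (suc i))) ⟩
  (f zero + g zero) + (∑ (λ i → f (suc i)) + ∑ (λ i → g (suc i)))
    ≡⟨ +-interchange (f zero) (g zero) _ _ ⟩
  (f zero + ∑ (λ i → f (suc i))) + (g zero + ∑ (λ i → g (suc i))) ∎
  where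
  open ≡-Reasoning
  +-interchange : ∀ a b c d → (a + b) + (c + d) ≡ (a + c) + (b + d)
  +-interchange = solve-∀ ℚ-ring

*-distribˡ-∑ : ∀ {n} (q : ℚ) (f : Fin n → ℚ) → q * ∑ f ≡ ∑ (λ i → q * f i)
*-distribˡ-∑ {zero}  q _ = *-zeroʳ q
*-distribˡ-∑ {suc n} q f =
  trans (*-distribˡ-+ q (f zero) _) (cong (q * f zero +_) (*-distribˡ-∑ q (λ i → f (suc i))))

*-distribʳ-∑ : ∀ {n} (q : ℚ) (f : Fin n → ℚ) → ∑ f * q ≡ ∑ (λ i → f i * q)
*-distribʳ-∑ q f = trans (*-comm _ q) (trans (*-distribˡ-∑ q f) (∑-cong (λ i → *-comm q (f i))))

∑-comm : ∀ {n m} (F : Fin n → Fin m → ℚ) → ∑ (λ i → ∑ (F i)) ≡ ∑ (λ j → ∑ (λ i → F i j))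
∑-comm {zero} {m} _ = sym (∑-zero {m} (λ _ → refl))
∑-comm {suc n} F = trans (cong (∑ (F zero) +_) (∑-comm (λ i → F (suc i))))
                         (sym (∑-distrib-+ (F zero) (λ j → ∑ (λ i → F (suc i) j))))

∑-mono-≤ : ∀ {n} {f g : Fin n → ℚ} → (∀ i → f i ≤ g i) → ∑ f ≤ ∑ g
∑-mono-≤ {zero}  _ = ≤-refl
∑-mono-≤ {suc n} f≤g = +-mono-≤ (f≤g zero) (∑-mono-≤ (λ i → f≤g (suc i)))

∣∑∣≤∑∣∣ : ∀ {n} (f : Fin n → ℚ) → ∣ ∑ f ∣ ≤ ∑ (λ i → ∣ f i ∣)
∣∑∣≤∑∣∣ {zero}  _ = ≤-refl
∣∑∣≤∑∣∣ {suc n} f =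
  ≤-trans (∣p+q∣≤∣p∣+∣q∣ (f zero) _) (+-monoʳ-≤ ∣ f zero ∣ (∣∑∣≤∑∣∣ (λ i → f (suc i))))

∣∑*∣≤ : ∀ {n} (w c : Fin n → ℚ) {R} → (∀ j → ∣ w j ∣ ≤ R) →
        ∣ ∑ (λ j → w j * c j) ∣ ≤ R * ∑ (λ j → ∣ c j ∣)
∣∑*∣≤ w c {R} ∣w∣≤R = ≤-trans (∣∑∣≤∑∣∣ (λ j → w j * c j))
  (subst (∑ (λ j → ∣ w j * c j ∣) ≤_) (sym (*-distribˡ-∑ R (λ j → ∣ c j ∣)))
    (∑-mono-≤ (λ j → subst (_≤ R * ∣ c j ∣) (sym (∣p*q∣≡∣p∣*∣q∣ (w j) (c j)))
                      (*-monoʳ-≤-nonNeg ∣ c j ∣ {{∣-∣-nonNeg (c j)}} (∣w∣≤R j)))))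

bilinear : ∀ {m} → (Fin m → Fin m → ℚ) → Vec m → Vec m → ℚ
bilinear H u v = ∑ (λ i → ∑ (λ j → (u i * v j) * H i j))

quadratic : ∀ {m} → (Fin m → Fin m → ℚ) → Vec m → ℚ
quadratic H v = bilinear H v v

PositiveDefinite : ∀ {m} → (Fin m → Fin m → ℚ) → Set
PositiveDefinite H = ∀ v → NonZero v → 0ℚ < quadratic H v

module _ {m} (H : Fin m → Fin m → ℚ) where

  bilinear-cong : ∀ {u u′ v v′ : Vec m} → u ≋ u′ → v ≋ v′ → bilinear H u v ≡ bilinear H u′ v′
  bilinear-cong u≋u′ v≋v′ =
    ∑-cong (λ i → ∑-cong (λ j → cong₂ (λ a b → (a * b) * H i j) (u≋u′ i) (v≋v′ j)))

  bilinear-zeroˡ : ∀ {u} v → u ≋ 𝟎 → bilinear H u v ≡ 0ℚ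
  bilinear-zeroˡ v u≋0 = ∑-zero (λ i → ∑-zero (λ j →
    trans (cong (λ a → (a * v j) * H i j) (u≋0 i)) (trans (cong (_* H i j) (*-zeroˡ (v j))) (*-zeroˡ (H i j)))))

  bilinear-zeroʳ : ∀ u {v} → v ≋ 𝟎 → bilinear H u v ≡ 0ℚ
  bilinear-zeroʳ u v≋0 = ∑-zero (λ i → ∑-zero (λ j →
    trans (cong (λ b → (u i * b) * H i j) (v≋0 j)) (trans (cong (_* H i j) (*-zeroʳ (u i))) (*-zeroˡ (H i j)))))

  bilinear-+ˡ : ∀ u u′ v → bilinear H (u ⊕ u′) v ≡ bilinear H u v + bilinear H u′ v
  bilinear-+ˡ u u′ v = trans
    (∑-cong (λ i → trans (∑-cong (λ j → distrib (u i) (u′ i) (v j) (H i j)))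
                         (∑-distrib-+ (λ j → (u i * v j) * H i j) (λ j → (u′ i * v j) * H i j))))
    (∑-distrib-+ (λ i → ∑ (λ j → (u i * v j) * H i j)) (λ i → ∑ (λ j → (u′ i * v j) * H i j)))
    where
    distrib : ∀ a b c h → ((a + b) * c) * h ≡ (a * c) * h + (b * c) * h
    distrib = solve-∀ ℚ-ring

  bilinear-+ʳ : ∀ u v v′ → bilinear H u (v ⊕ v′) ≡ bilinear H u v + bilinear H u v′
  bilinear-+ʳ u v v′ = trans
    (∑-cong (λ i → trans (∑-cong (λ j → distrib (u i) (v j) (v′ j) (H i j)))
                         (∑-distrib-+ (λ j → (u i * v j) * H i j) (λ j → (u i * v′ j) * H i j))))
    (∑-distrib-+ (λ i → ∑ (λ j → (u i * v j) * H i j)) (λ i → ∑ (λ j → (u i * v′ j) * H i j)))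
    where
    distrib : ∀ a b c h → (a * (b + c)) * h ≡ (a * b) * h + (a * c) * h
    distrib = solve-∀ ℚ-ring

  quadratic-+ : ∀ u v →
    quadratic H (u ⊕ v) ≡ (quadratic H u + bilinear H u v) + (bilinear H v u + quadratic H v)
  quadratic-+ u v = trans (bilinear-+ˡ u v (u ⊕ v)) (cong₂ _+_ (bilinear-+ʳ u u v) (bilinear-+ʳ v u v))

bilinear-outer : ∀ {m} (p q u v : Vec m) →
  bilinear (λ i j → p i * q j) u v ≡ ∑ (λ i → u i * p i) * ∑ (λ j → v j * q j)
bilinear-outer p q u v = begin
  ∑ (λ i → ∑ (λ j → (u i * v j) * (p i * q j)))
    ≡⟨ ∑-cong (λ i → trans (∑-cong (λ j → regroup (u i) (v j) (p i) (q j)))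
                           (sym (*-distribˡ-∑ (u i * p i) (λ j → v j * q j)))) ⟩
  ∑ (λ i → (u i * p i) * ∑ (λ j → v j * q j))
    ≡⟨ sym (*-distribʳ-∑ _ (λ i → u i * p i)) ⟩
  ∑ (λ i → u i * p i) * ∑ (λ j → v j * q j) ∎
  where
  open ≡-Reasoning
  regroup : ∀ a b c d → (a * b) * (c * d) ≡ (a * c) * (b * d)
  regroup = solve-∀ ℚ-ring

bilinear-+ᴴ : ∀ {m} (H H′ : Fin m → Fin m → ℚ) u v →
  bilinear (λ i j → H i j + H′ i j) u v ≡ bilinear H u v + bilinear H′ u v
bilinear-+ᴴ H H′ u v = trans
  (∑-cong (λ i → trans (∑-cong (λ j → *-distribˡ-+ (u i * v j) (H i j) (H′ i j)))
                       (∑-distrib-+ (λ j → (u i * v j) * H i j) (λ j → (u i * v j) * H′ i j))))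
  (∑-distrib-+ (λ i → ∑ (λ j → (u i * v j) * H i j)) (λ i → ∑ (λ j → (u i * v j) * H′ i j)))

quadratic-nonNeg : ∀ {m} {H : Fin m → Fin m → ℚ} → PositiveDefinite H → ∀ v → 0ℚ ≤ quadratic H v
quadratic-nonNeg {H = H} pd v with dec-≋𝟎 v
... | yes v≋0 = ≤-reflexive (sym (bilinear-zeroˡ H v v≋0))
... | no  v≢0 = <⇒≤ (pd v v≢0)

-- Positive definite forms have bounded sublevel sets

module CompletingTheSquare {m} (g : Fin (suc m) → Fin (suc m) → ℚ) where

  a : ℚ
  a = g zero zero

  cross : Fin m → ℚ
  cross j = g zero (suc j) + g (suc j) zero

  g′ : Fin m → Fin m → ℚ
  g′ i j = g (suc i) (suc j)

  ℓ : Vec m → ℚ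
  ℓ w = ∑ (λ j → w j * cross j)

  quadratic-∷ : ∀ t w → quadratic g (t ∷ᵥ w) ≡ (t * t) * a + (t * ℓ w + quadratic g′ w)
  quadratic-∷ t w = begin
    ((t * t) * a + X) + ∑ (λ i → (w i * t) * g (suc i) zero + ∑ (λ j → (w i * w j) * g′ i j))
      ≡⟨ cong (((t * t) * a + X) +_) (∑-distrib-+ (λ i → (w i * t) * g (suc i) zero) _) ⟩
    ((t * t) * a + X) + (Y + quadratic g′ w)
      ≡⟨ reassoc ((t * t) * a) X Y (quadratic g′ w) ⟩
    (t * t) * a + ((X + Y) + quadratic g′ w)
      ≡⟨ cong (λ u → (t * t) * a + (u + quadratic g′ w)) (sym t*ℓ≡X+Y) ⟩
    (t * t) * a + (t * ℓ w + quadratic g′ w) ∎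
    where
    open ≡-Reasoning
    X = ∑ (λ j → (t * w j) * g zero (suc j))
    Y = ∑ (λ i → (w i * t) * g (suc i) zero)
    reassoc : ∀ A X Y Q → (A + X) + (Y + Q) ≡ A + ((X + Y) + Q)
    reassoc = solve-∀ ℚ-ring
    spread : ∀ t w p q → t * (w * (p + q)) ≡ (t * w) * p + (w * t) * q
    spread = solve-∀ ℚ-ring
    t*ℓ≡X+Y : t * ℓ w ≡ X + Y
    t*ℓ≡X+Y = trans (*-distribˡ-∑ t (λ j → w j * cross j))
      (trans (∑-cong (λ j → spread t (w j) (g zero (suc j)) (g (suc j) zero)))
             (∑-distrib-+ (λ j → (t * w j) * g zero (suc j)) (λ i → (w i * t) * g (suc i) zero)))

  module _ (pd : PositiveDefinite g) where

    a-pos : 0ℚ < a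
    a-pos = subst (0ℚ <_) quadratic-e₀ (pd (1ℚ ∷ᵥ 𝟎) (λ e₀≋0 → 1≢0 (e₀≋0 zero)))
      where
      collapse : ∀ a → (1ℚ * 1ℚ) * a + (1ℚ * 0ℚ + 0ℚ) ≡ a
      collapse = solve-∀ ℚ-ring
      quadratic-e₀ : quadratic g (1ℚ ∷ᵥ 𝟎) ≡ a
      quadratic-e₀ = trans (quadratic-∷ 1ℚ 𝟎)
        (trans (cong₂ (λ l q → (1ℚ * 1ℚ) * a + (1ℚ * l + q))
                      (∑-zero (λ j → *-zeroˡ (cross j))) (bilinear-zeroˡ g′ 𝟎 (λ _ → refl)))
               (collapse a))

    instance
      a+a≢0 : ℚ.NonZero (a + a)
      a+a≢0 = pos⇒nonZero (a + a) {{positive (+-mono-< a-pos a-pos)}}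

    1/2a : ℚ
    1/2a = 1/ (a + a)

    K : ℚ
    K = a * 1/2a * 1/2a

    schur : Fin m → Fin m → ℚ
    schur i j = g′ i j + (- K * cross i) * cross j

    quadratic-schur : ∀ w → quadratic schur w ≡ quadratic g′ w + (- K) * (ℓ w * ℓ w)
    quadratic-schur w = begin
      quadratic schur w
        ≡⟨ bilinear-+ᴴ g′ (λ i j → (- K * cross i) * cross j) w w ⟩
      quadratic g′ w + bilinear (λ i j → (- K * cross i) * cross j) w w
        ≡⟨ cong (quadratic g′ w +_) (bilinear-outer (λ i → - K * cross i) cross w w) ⟩
      quadratic g′ w + ∑ (λ i → w i * (- K * cross i)) * ℓ w
        ≡⟨ cong (λ s → quadratic g′ w + s * ℓ w) (trans (∑-cong (λ i → pull (w i) (- K) (cross i)))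
                                                   (sym (*-distribˡ-∑ (- K) (λ i → w i * cross i)))) ⟩
      quadratic g′ w + ((- K) * ℓ w) * ℓ w
        ≡⟨ cong (quadratic g′ w +_) (*-assoc (- K) (ℓ w) (ℓ w)) ⟩
      quadratic g′ w + (- K) * (ℓ w * ℓ w) ∎
      where
      open ≡-Reasoning
      pull : ∀ w k c → w * (k * c) ≡ k * (w * c)
      pull = solve-∀ ℚ-ring

    -- The cross term t ℓ is rewritten as t ℓ (2a · 1/2a), which the ring solver can then absorb.
    completing-square : ∀ t w →
      quadratic g (t ∷ᵥ w) ≡ quadratic schur w + a * ((t + ℓ w * 1/2a) * (t + ℓ w * 1/2a))
    completing-square t w = begin
      quadratic g (t ∷ᵥ w)
        ≡⟨ quadratic-∷ t w ⟩
      (t * t) * a + (t * ℓ w + quadratic g′ w)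
        ≡⟨ cong (λ u → (t * t) * a + (u + quadratic g′ w))
                (trans (sym (*-identityʳ (t * ℓ w))) (cong (t * ℓ w *_) (sym 2a/2a≡1))) ⟩
      (t * t) * a + (t * ℓ w * ((a + a) * 1/2a) + quadratic g′ w)
        ≡⟨ square (quadratic g′ w) a t (ℓ w) 1/2a ⟩
      (quadratic g′ w + (- K) * (ℓ w * ℓ w)) + a * ((t + ℓ w * 1/2a) * (t + ℓ w * 1/2a))
        ≡⟨ cong (_+ a * ((t + ℓ w * 1/2a) * (t + ℓ w * 1/2a))) (sym (quadratic-schur w)) ⟩
      quadratic schur w + a * ((t + ℓ w * 1/2a) * (t + ℓ w * 1/2a)) ∎
      where
      open ≡-Reasoning
      2a/2a≡1 : (a + a) * 1/2a ≡ 1ℚ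
      2a/2a≡1 = *-inverseʳ (a + a)
      square : ∀ Q a t l J → (t * t) * a + (t * l * ((a + a) * J) + Q)
                           ≡ (Q + (- (a * J * J)) * (l * l)) + a * ((t + l * J) * (t + l * J))
      square = solve-∀ ℚ-ring

    schur-positiveDefinite : PositiveDefinite schur
    schur-positiveDefinite w w≢0 = subst (0ℚ <_) quadratic-g≡schur (pd (t₀ ∷ᵥ w) (λ v≋0 → w≢0 (λ j → v≋0 (suc j))))
      where
      t₀ : ℚ
      t₀ = - (ℓ w * 1/2a)
      quadratic-g≡schur : quadratic g (t₀ ∷ᵥ w) ≡ quadratic schur w
      quadratic-g≡schur = begin
        quadratic g (t₀ ∷ᵥ w)
          ≡⟨ completing-square t₀ w ⟩
        quadratic schur w + a * ((t₀ + ℓ w * 1/2a) * (t₀ + ℓ w * 1/2a))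
          ≡⟨ cong (λ s → quadratic schur w + a * (s * s)) (+-inverseˡ (ℓ w * 1/2a)) ⟩
        quadratic schur w + a * (0ℚ * 0ℚ)
          ≡⟨ cong (quadratic schur w +_) (*-zeroʳ a) ⟩
        quadratic schur w + 0ℚ
          ≡⟨ +-identityʳ _ ⟩
        quadratic schur w ∎
        where open ≡-Reasoning

sublevel-bounded : ∀ {m} (g : Fin m → Fin m → ℚ) → PositiveDefinite g →
  ∀ T → Σ ℚ λ R → ∀ v → quadratic g v ≤ T → ∀ k → ∣ v k ∣ ≤ R
sublevel-bounded {zero}  _ _ _ = 0ℚ , λ _ _ ()
sublevel-bounded {suc m} g pd T = R′ ⊔ R₀ , bound
  where
  open CompletingTheSquare g
  instance
    a≢0 : ℚ.NonZero a
    a≢0 = pos⇒nonZero a {{positive (a-pos pd)}}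
  IH = sublevel-bounded (schur pd) (schur-positiveDefinite pd) T
  R′ = proj₁ IH
  R₀ = (1ℚ ⊔ (1/ a * T)) + (R′ * ∑ (λ j → ∣ cross j ∣)) * ∣ 1/2a pd ∣
  bound : ∀ v → quadratic g v ≤ T → ∀ k → ∣ v k ∣ ≤ R′ ⊔ R₀
  bound v Qv≤T = λ { zero → ≤-trans ∣t∣≤R₀ (p≤q⊔p R′ R₀) ; (suc j) → ≤-trans (∣w∣≤R′ j) (p≤p⊔q R′ R₀) }
    where
    t = head v
    w = tail v
    s = t + ℓ w * 1/2a pd
    Qv≡ : quadratic g v ≡ quadratic (schur pd) w + a * (s * s)
    Qv≡ = completing-square pd t w
    ∣w∣≤R′ : ∀ j → ∣ w j ∣ ≤ R′
    ∣w∣≤R′ = proj₂ IH w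
      (≤-trans (≤-of-+ˡ Qv≡ (*-nonNeg (<⇒≤ (a-pos pd)) (p*p-nonNeg s))) Qv≤T)
    s*s≤T/a : s * s ≤ 1/ a * T
    s*s≤T/a = subst (_≤ 1/ a * T)
      (trans (sym (*-assoc (1/ a) a (s * s))) (trans (cong (_* (s * s)) (*-inverseˡ a)) (*-identityˡ (s * s))))
      (*-monoˡ-≤-nonNeg (1/ a) {{pos⇒nonNeg (1/ a) {{1/pos⇒pos a {{positive (a-pos pd)}}}}}}
        (≤-trans (≤-of-+ʳ Qv≡ (quadratic-nonNeg (schur-positiveDefinite pd) w)) Qv≤T))
    ∣ℓw∣∣1/2a∣≤ : ∣ ℓ w ∣ * ∣ 1/2a pd ∣ ≤ (R′ * ∑ (λ j → ∣ cross j ∣)) * ∣ 1/2a pd ∣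
    ∣ℓw∣∣1/2a∣≤ = *-monoʳ-≤-nonNeg ∣ 1/2a pd ∣ {{∣-∣-nonNeg (1/2a pd)}} (∣∑*∣≤ w cross ∣w∣≤R′)
    shift : ∀ t x → t ≡ (t + x) + (- x)
    shift = solve-∀ ℚ-ring
    ∣t∣≤R₀ : ∣ t ∣ ≤ R₀
    ∣t∣≤R₀ = begin
      ∣ t ∣                            ≡⟨ cong ∣_∣ (shift t (ℓ w * 1/2a pd)) ⟩
      ∣ s + - (ℓ w * 1/2a pd) ∣        ≤⟨ ∣p+q∣≤∣p∣+∣q∣ s _ ⟩
      ∣ s ∣ + ∣ - (ℓ w * 1/2a pd) ∣    ≡⟨ cong (∣ s ∣ +_) (trans (∣-p∣≡∣p∣ _) (∣p*q∣≡∣p∣*∣q∣ (ℓ w) (1/2a pd))) ⟩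
      ∣ s ∣ + ∣ ℓ w ∣ * ∣ 1/2a pd ∣    ≤⟨ +-mono-≤ (∣p∣≤1⊔p*p s _ s*s≤T/a) ∣ℓw∣∣1/2a∣≤ ⟩
      R₀ ∎
      where open ≤-Reasoning

-- The embedding used by ℤcomb, so ℤcomb g c k is ∑ (λ i → ι (c i) * g i k) by definition.
ι : ℤ → ℚ
ι z = z / 1

toℚᵘ-ι : ∀ a → toℚᵘ (ι a) ℚᵘ.≃ ℚᵘ.mkℚᵘ a 0
toℚᵘ-ι a = toℚᵘ-fromℚᵘ (ℚᵘ.mkℚᵘ a 0)

ι-+ : ∀ a b → ι (a ℤ.+ b) ≡ ι a + ι b
ι-+ a b = toℚᵘ-injective (ℚᵘ.≃-trans (toℚᵘ-ι (a ℤ.+ b)) (ℚᵘ.≃-sym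
  (ℚᵘ.≃-trans (toℚᵘ-homo-+ (ι a) (ι b)) (ℚᵘ.≃-trans (ℚᵘ.+-cong (toℚᵘ-ι a) (toℚᵘ-ι b)) (ℚᵘ.*≡* a+b≡a+b)))))
  where
  a+b≡a+b : (a ℤ.* ℤ.+ 1 ℤ.+ b ℤ.* ℤ.+ 1) ℤ.* ℤ.+ 1 ≡ (a ℤ.+ b) ℤ.* ℤ.+ 1
  a+b≡a+b = trans (ℤ.*-identityʳ _) (trans (cong₂ ℤ._+_ (ℤ.*-identityʳ a) (ℤ.*-identityʳ b))
                                           (sym (ℤ.*-identityʳ (a ℤ.+ b))))

ι-* : ∀ a b → ι (a ℤ.* b) ≡ ι a * ι b
ι-* a b = toℚᵘ-injective (ℚᵘ.≃-trans (toℚᵘ-ι (a ℤ.* b)) (ℚᵘ.≃-sym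
  (ℚᵘ.≃-trans (toℚᵘ-homo-* (ι a) (ι b)) (ℚᵘ.≃-trans (ℚᵘ.*-cong (toℚᵘ-ι a) (toℚᵘ-ι b)) (ℚᵘ.*≡* refl)))))

ι-mono-≤ : ∀ {a b} → a ℤ.≤ b → ι a ≤ ι b
ι-mono-≤ {a} {b} a≤b = toℚᵘ-cancel-≤ (ℚᵘ.≤-respˡ-≃ (ℚᵘ.≃-sym (toℚᵘ-ι a)) (ℚᵘ.≤-respʳ-≃ (ℚᵘ.≃-sym (toℚᵘ-ι b))
  (ℚᵘ.*≤* (subst₂ ℤ._≤_ (sym (ℤ.*-identityʳ a)) (sym (ℤ.*-identityʳ b)) a≤b))))

ι-cancel-≤ : ∀ {a b} → ι a ≤ ι b → a ℤ.≤ b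
ι-cancel-≤ {a} {b} ιa≤ιb = subst₂ ℤ._≤_ (ℤ.*-identityʳ a) (ℤ.*-identityʳ b)
  (ℚᵘ.drop-*≤* (ℚᵘ.≤-respˡ-≃ (toℚᵘ-ι a) (ℚᵘ.≤-respʳ-≃ (toℚᵘ-ι b) (toℚᵘ-mono-≤ ιa≤ιb))))

ι-nonNeg : ∀ n → 0ℚ ≤ ι (ℤ.+ n)
ι-nonNeg n = ι-mono-≤ {ℤ.+ 0} {ℤ.+ n} (ℤ.+≤+ ℕ.z≤n)

1≤ι[1+n] : ∀ n → 1ℚ ≤ ι (ℤ.+ suc n)
1≤ι[1+n] n = ι-mono-≤ {ℤ.+ 1} {ℤ.+ suc n} (ℤ.+≤+ (ℕ.s≤s ℕ.z≤n))

∣ι∣ : ∀ a → ∣ ι a ∣ ≡ ι (ℤ.+ ℤ.∣ a ∣)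
∣ι∣ (ℤ.+ n)  = 0≤p⇒∣p∣≡p (ι-nonNeg n)
∣ι∣ -[1+ n ] = trans (∣-p∣≡∣p∣ (ι (ℤ.+ suc n))) (0≤p⇒∣p∣≡p (ι-nonNeg (suc n)))

↧*p≡↥p : ∀ p → ι (ℤ.+ ↧ₙ p) * p ≡ ι (↥ p)
↧*p≡↥p p@(mkℚ n d-1 _) = toℚᵘ-injective (ℚᵘ.≃-trans (toℚᵘ-homo-* (ι (ℤ.+ suc d-1)) p)
  (ℚᵘ.≃-trans (ℚᵘ.*-congʳ (toℚᵘ-ι (ℤ.+ suc d-1))) (ℚᵘ.≃-trans (ℚᵘ.*≡* d*n≡n*d) (ℚᵘ.≃-sym (toℚᵘ-ι n)))))
  where
  d*n≡n*d : (ℤ.+ suc d-1 ℤ.* n) ℤ.* ℤ.+ 1 ≡ n ℤ.* ℤ.+ (1 ℕ.* suc d-1)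
  d*n≡n*d = trans (ℤ.*-identityʳ _)
    (trans (ℤ.*-comm (ℤ.+ suc d-1) n) (cong (λ k → n ℤ.* ℤ.+ k) (sym (ℕ.*-identityˡ (suc d-1)))))

p≤ι∣↥p∣ : ∀ p → p ≤ ι (ℤ.+ ℤ.∣ ↥ p ∣)
p≤ι∣↥p∣ p@(mkℚ n d-1 _) = begin
  p                              ≤⟨ p≤∣p∣ p ⟩
  ∣ p ∣                          ≡⟨ *-identityˡ ∣ p ∣ ⟨
  1ℚ * ∣ p ∣                     ≤⟨ *-monoʳ-≤-nonNeg ∣ p ∣ {{∣-∣-nonNeg p}} (1≤ι[1+n] d-1) ⟩
  ι (ℤ.+ suc d-1) * ∣ p ∣        ≡⟨ cong (_* ∣ p ∣) (0≤p⇒∣p∣≡p (ι-nonNeg (suc d-1))) ⟨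
  ∣ ι (ℤ.+ suc d-1) ∣ * ∣ p ∣    ≡⟨ ∣p*q∣≡∣p∣*∣q∣ (ι (ℤ.+ suc d-1)) p ⟨
  ∣ ι (ℤ.+ suc d-1) * p ∣        ≡⟨ cong ∣_∣ (↧*p≡↥p p) ⟩
  ∣ ι n ∣                        ≡⟨ ∣ι∣ n ⟩
  ι (ℤ.+ ℤ.∣ n ∣) ∎
  where open ≤-Reasoning

sumℤ : ∀ {n} → (Fin n → ℤ) → ℤ
sumℤ {zero}  _ = ℤ.+ 0
sumℤ {suc n} f = f zero ℤ.+ sumℤ (λ i → f (suc i))

ι-sumℤ : ∀ {n} (f : Fin n → ℤ) → ι (sumℤ f) ≡ ∑ (λ i → ι (f i))
ι-sumℤ {zero}  _ = refl
ι-sumℤ {suc n} f = trans (ι-+ (f zero) _) (cong (ι (f zero) +_) (ι-sumℤ (λ i → f (suc i))))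

Integral : ℚ → Set
Integral q = Σ ℤ λ z → q ≡ ι z

ClearedBy : ℕ → ℚ → Set
ClearedBy M q = Integral (ι (ℤ.+ M) * q)

clearedBy-* : ∀ K {M q} → ClearedBy M q → ClearedBy (K ℕ.* M) q
clearedBy-* K {M} {q} (z , Mq≡z) = ℤ.+ K ℤ.* z , (begin
  ι (ℤ.+ (K ℕ.* M)) * q            ≡⟨ cong (λ u → ι u * q) (ℤ.pos-* K M) ⟩
  ι (ℤ.+ K ℤ.* ℤ.+ M) * q          ≡⟨ cong (_* q) (ι-* (ℤ.+ K) (ℤ.+ M)) ⟩
  (ι (ℤ.+ K) * ι (ℤ.+ M)) * q      ≡⟨ *-assoc (ι (ℤ.+ K)) (ι (ℤ.+ M)) q ⟩
  ι (ℤ.+ K) * (ι (ℤ.+ M) * q)      ≡⟨ cong (ι (ℤ.+ K) *_) Mq≡z ⟩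
  ι (ℤ.+ K) * ι z                  ≡⟨ ι-* (ℤ.+ K) z ⟨
  ι (ℤ.+ K ℤ.* z) ∎)
  where open ≡-Reasoning

common-multiple : ∀ {r} (C : Fin r → ℕ → Set) → (∀ i K {M} → C i M → C i (K ℕ.* M)) →
  (∀ i → Σ ℕ λ M → C i (suc M)) → Σ ℕ λ M → ∀ i → C i (suc M)
common-multiple {zero}  _ _ _ = 0 , λ ()
common-multiple {suc r} C scale c = Mᵣ ℕ.+ M₀ ℕ.* suc Mᵣ , λ
  { zero    → subst (C zero) (ℕ.*-comm (suc Mᵣ) (suc M₀)) (scale zero (suc Mᵣ) (proj₂ (c zero)))
  ; (suc i) → scale (suc i) (suc M₀) (proj₂ rest i) }
  where
  M₀ = proj₁ (c zero)
  rest = common-multiple (λ i → C (suc i)) (λ i → scale (suc i)) (λ i → c (suc i))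
  Mᵣ = proj₁ rest

common-denominator : ∀ {r} (F : Fin r → ℚ) → Σ ℕ λ M → ∀ i → ClearedBy (suc M) (F i)
common-denominator F = common-multiple (λ i M → ClearedBy M (F i)) (λ i K → clearedBy-* K)
  (λ i → let p = F i in ℕ.pred (↧ₙ p) , ↥ p , ↧*p≡↥p p)

common-denominator₂ : ∀ {r s} (G : Fin r → Fin s → ℚ) → Σ ℕ λ M → ∀ i j → ClearedBy (suc M) (G i j)
common-denominator₂ G = common-multiple (λ i M → ∀ j → ClearedBy M (G i j)) (λ i K c j → clearedBy-* K (c j))
  (λ i → common-denominator (G i))

functions : ∀ {A : Set} {s} → (Fin s → List A) → List (Fin s → A)
functions {s = zero}  xs = [ (λ ()) ]
functions {s = suc s} xs = concatMap (λ a → map (a ∷ᵥ_) (functions (tail xs))) (head xs)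

functions-complete : ∀ {A : Set} {s} (xs : Fin s → List A) {f : Fin s → A} →
  (∀ i → f i ∈ xs i) → Any (_≗ f) (functions xs)
functions-complete {s = zero}  _ _ = here (λ ())
functions-complete {s = suc s} xs {f} f∈xs = Any.concatMap⁺ _ (Any.map extend (f∈xs zero))
  where
  extend : ∀ {a} → f zero ≡ a → Any (_≗ f) (map (a ∷ᵥ_) (functions (tail xs)))
  extend refl = Any.map⁺ (Any.map (λ g≗tail → λ { zero → refl ; (suc i) → g≗tail i })
                                  (functions-complete (tail xs) (λ i → f∈xs (suc i))))

integers-within : ℕ → List ℤ
integers-within W = map ℤ.+_ (upTo (suc W)) ++ map -[1+_] (upTo W)

integers-within-complete : ∀ {z W} → ℤ.∣ z ∣ ℕ.≤ W → z ∈ integers-within W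
integers-within-complete {ℤ.+ n}    ∣z∣≤W = ∈-++⁺ˡ (∈-map⁺ ℤ.+_ (∈-upTo⁺ (ℕ.s≤s ∣z∣≤W)))
integers-within-complete { -[1+ n ]} {W} ∣z∣≤W = ∈-++⁺ʳ (map ℤ.+_ (upTo (suc W))) (∈-map⁺ -[1+_] (∈-upTo⁺ ∣z∣≤W))

countBelow : ℚ → List ℚ → ℕ
countBelow _ [] = 0
countBelow t (v ∷ vs) with v <? t
... | yes _ = suc (countBelow t vs)
... | no  _ = countBelow t vs

countBelow-mono-≤ : ∀ {a b} → a ≤ b → ∀ vs → countBelow a vs ℕ.≤ countBelow b vs
countBelow-mono-≤ _ [] = ℕ.z≤n
countBelow-mono-≤ {a} {b} a≤b (v ∷ vs) with v <? a | v <? b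
... | yes _   | yes _   = ℕ.s≤s (countBelow-mono-≤ a≤b vs)
... | yes v<a | no  v≮b = ⊥-elim (v≮b (<-≤-trans v<a a≤b))
... | no  _   | yes _   = ℕ.m≤n⇒m≤1+n (countBelow-mono-≤ a≤b vs)
... | no  _   | no  _   = countBelow-mono-≤ a≤b vs

countBelow-mono-< : ∀ {a b} → a < b → ∀ {vs} → a ∈ vs → countBelow a vs ℕ.< countBelow b vs
countBelow-mono-< {a} {b} a<b {v ∷ vs} (here a≡v) with v <? a | v <? b
... | yes v<a | _       = ⊥-elim (<-irrefl (sym a≡v) v<a)
... | no  _   | yes _   = ℕ.s≤s (countBelow-mono-≤ (<⇒≤ a<b) vs)
... | no  _   | no  v≮b = ⊥-elim (v≮b (subst (_< b) a≡v a<b))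
countBelow-mono-< {a} {b} a<b {v ∷ vs} (there a∈vs) with v <? a | v <? b
... | yes _   | yes _   = ℕ.s≤s (countBelow-mono-< a<b a∈vs)
... | yes v<a | no  v≮b = ⊥-elim (v≮b (<-trans v<a a<b))
... | no  _   | yes _   = ℕ.m≤n⇒m≤1+n (countBelow-mono-< a<b a∈vs)
... | no  _   | no  _   = countBelow-mono-< a<b a∈vs

-- Lattices are covered by finitely many cosets of N ℤ^m

basis : ∀ {m} → Fin m → Vec m
basis zero    zero     = 1ℚ
basis zero    (suc _)  = 0ℚ
basis (suc _) zero     = 0ℚ
basis (suc k) (suc k′) = basis k k′

∑-basis : ∀ {m} (f : Fin m → ℚ) k′ → ∑ (λ k → f k * basis k k′) ≡ f k′
∑-basis f zero = trans (cong₂ _+_ (*-identityʳ (f zero)) (∑-zero (λ k → *-zeroʳ (f (suc k))))) (+-identityʳ (f zero))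
∑-basis f (suc k′) = trans (cong₂ _+_ (*-zeroʳ (f zero)) (∑-basis (λ k → f (suc k)) k′)) (+-identityˡ (f (suc k′)))

_⊖_ : ∀ {m} → Vec m → Vec m → Vec m
(x ⊖ y) k = x k - y k

module _ {m s} (g : Fin s → Vec m) where

  ℤcomb-cong : ∀ {a b : Fin s → ℤ} → a ≗ b → ℤcomb g a ≋ ℤcomb g b
  ℤcomb-cong a≗b k = ∑-cong (λ i → cong (λ z → ι z * g i k) (a≗b i))

  ℤcomb-+ : ∀ a b → ℤcomb g (λ i → a i ℤ.+ b i) ≋ (ℤcomb g a ⊕ ℤcomb g b)
  ℤcomb-+ a b k = trans
    (∑-cong (λ i → trans (cong (_* g i k) (ι-+ (a i) (b i))) (*-distribʳ-+ (g i k) (ι (a i)) (ι (b i)))))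
    (∑-distrib-+ (λ i → ι (a i) * g i k) (λ i → ι (b i) * g i k))

  InZSpan-⊖ : ∀ {x y} → InZSpan g x → InZSpan g y → InZSpan g (x ⊖ y)
  InZSpan-⊖ {x} {y} (a , x≋a) (b , y≋b) = a-b , λ k → begin
    x k - y k                                      ≡⟨ cong₂ _-_ (x≋a k) (y≋b k) ⟩
    ℤcomb g a k - ℤcomb g b k                      ≡⟨ cong (_- ℤcomb g b k) (ℤcomb-cong (λ i → i-j+j≡i (a i) (b i)) k) ⟨
    ℤcomb g (λ i → a-b i ℤ.+ b i) k - ℤcomb g b k  ≡⟨ cong (_- ℤcomb g b k) (ℤcomb-+ a-b b k) ⟩
    (ℤcomb g a-b k + ℤcomb g b k) - ℤcomb g b k    ≡⟨ u+v-v≡u (ℤcomb g a-b k) (ℤcomb g b k) ⟩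
    ℤcomb g a-b k ∎
    where
    open ≡-Reasoning
    a-b : Fin s → ℤ
    a-b i = a i ℤ.- b i
    i-j+j≡i : ∀ i j → (i ℤ.- j) ℤ.+ j ≡ i
    i-j+j≡i i j = trans (ℤ.+-assoc i (ℤ.- j) j) (trans (cong (λ k → i ℤ.+ k) (ℤ.+-inverseˡ j)) (ℤ.+-identityʳ i))
    u+v-v≡u : ∀ u v → (u + v) - v ≡ u
    u+v-v≡u = solve-∀ ℚ-ring

module Lattice {m s} (L : Fin s → Vec m) (spans : SpansQ L) where

  private
    D-clears : Σ ℕ λ M → ∀ i k → ClearedBy (suc M) (L i k)
    D-clears = common-denominator₂ L
    coordinates : Fin m → Fin s → ℚ
    coordinates k = proj₁ (spans (basis k))
    N-clears : Σ ℕ λ M → ∀ k i → ClearedBy (suc M) (coordinates k i)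
    N-clears = common-denominator₂ coordinates

  -- D clears the denominators of the generators and N those of the standard basis
  -- written in terms of the generators, so that D L ⊆ ℤ^m and N ℤ^m ⊆ L.
  D N P : ℕ
  D = suc (proj₁ D-clears)
  N = suc (proj₁ N-clears)
  P = N ℕ.* D

  instance
    P≢0 : ℕ.NonZero P
    P≢0 = ℕ.m*n≢0 N D

  ιN : ℚ
  ιN = ι (ℤ.+ N)

  DL : Fin s → Fin m → ℤ
  DL i k = proj₁ (proj₂ D-clears i k)

  α : Fin m → Fin s → ℤ
  α k i = proj₁ (proj₂ N-clears k i)

  N·basis : ∀ k → ℤcomb L (α k) ≋ (ιN ⊙ basis k)
  N·basis k k′ = begin
    ∑ (λ i → ι (α k i) * L i k′)               ≡⟨ ∑-cong (λ i → cong (_* L i k′) (sym (proj₂ (proj₂ N-clears k i)))) ⟩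
    ∑ (λ i → (ιN * coordinates k i) * L i k′)  ≡⟨ ∑-cong (λ i → *-assoc ιN (coordinates k i) (L i k′)) ⟩
    ∑ (λ i → ιN * (coordinates k i * L i k′))  ≡⟨ *-distribˡ-∑ ιN (λ i → coordinates k i * L i k′) ⟨
    ιN * ℚcomb L (coordinates k) k′            ≡⟨ cong (ιN *_) (proj₂ (spans (basis k)) k′) ⟨
    ιN * basis k k′ ∎
    where open ≡-Reasoning

  N-times : (Fin m → ℤ) → Vec m
  N-times w k = ιN * ι (w k)

  ℤcomb-N-times : ∀ w → ℤcomb L (λ i → sumℤ (λ k → w k ℤ.* α k i)) ≋ N-times w
  ℤcomb-N-times w k′ = begin
    ∑ (λ i → ι (sumℤ (λ k → w k ℤ.* α k i)) * L i k′)
      ≡⟨ ∑-cong (λ i → trans (cong (_* L i k′) (ι-sumℤ (λ k → w k ℤ.* α k i)))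
                             (*-distribʳ-∑ (L i k′) (λ k → ι (w k ℤ.* α k i)))) ⟩
    ∑ (λ i → ∑ (λ k → ι (w k ℤ.* α k i) * L i k′))
      ≡⟨ ∑-cong (λ i → ∑-cong (λ k → trans (cong (_* L i k′) (ι-* (w k) (α k i))) (*-assoc (ι (w k)) _ _))) ⟩
    ∑ (λ i → ∑ (λ k → ι (w k) * (ι (α k i) * L i k′)))
      ≡⟨ ∑-comm (λ i k → ι (w k) * (ι (α k i) * L i k′)) ⟩
    ∑ (λ k → ∑ (λ i → ι (w k) * (ι (α k i) * L i k′)))
      ≡⟨ ∑-cong (λ k → trans (sym (*-distribˡ-∑ (ι (w k)) (λ i → ι (α k i) * L i k′)))
                             (cong (ι (w k) *_) (N·basis k k′))) ⟩
    ∑ (λ k → ι (w k) * (ιN * basis k k′))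
      ≡⟨ ∑-cong (λ k → sym (*-assoc (ι (w k)) ιN (basis k k′))) ⟩
    ∑ (λ k → (ι (w k) * ιN) * basis k k′)
      ≡⟨ ∑-basis (λ k → ι (w k) * ιN) k′ ⟩
    ι (w k′) * ιN
      ≡⟨ *-comm (ι (w k′)) ιN ⟩
    ιN * ι (w k′) ∎
    where open ≡-Reasoning

  representative : (Fin s → ℕ) → Vec m
  representative ρ = ℤcomb L (λ i → ℤ.+ ρ i)

  coset : (Fin s → ℕ) → (Fin m → ℤ) → Fin s → ℤ
  coset ρ w i = ℤ.+ ρ i ℤ.+ sumℤ (λ k → w k ℤ.* α k i)

  ℤcomb-coset : ∀ ρ w → ℤcomb L (coset ρ w) ≋ (representative ρ ⊕ N-times w)
  ℤcomb-coset ρ w k = trans (ℤcomb-+ L (λ i → ℤ.+ ρ i) (λ i → sumℤ (λ k → w k ℤ.* α k i)) k)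
                            (cong (representative ρ k +_) (ℤcomb-N-times w k))

  residue : (Fin s → ℤ) → Fin s → ℕ
  residue c i = c i ℤ.%ℕ P

  carry : (Fin s → ℤ) → Fin m → ℤ
  carry c k = sumℤ (λ i → (c i ℤ./ℕ P) ℤ.* DL i k)

  -- Writing c = residue + P · quotient, the P-multiples contribute N · (D L) with D L integral.
  ℤcomb-reduce : ∀ c → ℤcomb L c ≋ (representative (residue c) ⊕ N-times (carry c))
  ℤcomb-reduce c k = begin
    ℤcomb L c k
      ≡⟨ ℤcomb-cong L (λ i → ℤ.a≡a%ℕn+[a/ℕn]*n (c i) P) k ⟩
    ℤcomb L (λ i → ℤ.+ residue c i ℤ.+ q i ℤ.* ℤ.+ P) k
      ≡⟨ ℤcomb-+ L (λ i → ℤ.+ residue c i) (λ i → q i ℤ.* ℤ.+ P) k ⟩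
    representative (residue c) k + ∑ (λ i → ι (q i ℤ.* ℤ.+ P) * L i k)
      ≡⟨ cong (representative (residue c) k +_) multiples ⟩
    representative (residue c) k + ιN * ι (carry c k) ∎
    where
    open ≡-Reasoning
    q : Fin s → ℤ
    q i = c i ℤ./ℕ P
    regroup : ∀ q n d l → (q * (n * d)) * l ≡ n * (q * (d * l))
    regroup = solve-∀ ℚ-ring
    ι[qP]L : ∀ i → ι (q i ℤ.* ℤ.+ P) * L i k ≡ ιN * ι (q i ℤ.* DL i k)
    ι[qP]L i = begin
      ι (q i ℤ.* ℤ.+ P) * L i k
        ≡⟨ cong (λ z → ι (q i ℤ.* z) * L i k) (ℤ.pos-* N D) ⟩
      ι (q i ℤ.* (ℤ.+ N ℤ.* ℤ.+ D)) * L i k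
        ≡⟨ cong (_* L i k) (trans (ι-* (q i) _) (cong (ι (q i) *_) (ι-* (ℤ.+ N) (ℤ.+ D)))) ⟩
      (ι (q i) * (ιN * ι (ℤ.+ D))) * L i k
        ≡⟨ regroup (ι (q i)) ιN (ι (ℤ.+ D)) (L i k) ⟩
      ιN * (ι (q i) * (ι (ℤ.+ D) * L i k))
        ≡⟨ cong (λ z → ιN * (ι (q i) * z)) (proj₂ (proj₂ D-clears i k)) ⟩
      ιN * (ι (q i) * ι (DL i k))
        ≡⟨ cong (ιN *_) (ι-* (q i) (DL i k)) ⟨
      ιN * ι (q i ℤ.* DL i k) ∎
    multiples : ∑ (λ i → ι (q i ℤ.* ℤ.+ P) * L i k) ≡ ιN * ι (carry c k)
    multiples = begin
      ∑ (λ i → ι (q i ℤ.* ℤ.+ P) * L i k)   ≡⟨ ∑-cong ι[qP]L ⟩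
      ∑ (λ i → ιN * ι (q i ℤ.* DL i k))     ≡⟨ *-distribˡ-∑ ιN (λ i → ι (q i ℤ.* DL i k)) ⟨
      ιN * ∑ (λ i → ι (q i ℤ.* DL i k))     ≡⟨ cong (ιN *_) (ι-sumℤ (λ i → q i ℤ.* DL i k)) ⟨
      ιN * ι (carry c k) ∎

  representative-bound : Fin m → ℚ
  representative-bound k = ∑ (λ i → ι (ℤ.+ P) * ∣ L i k ∣)

  ∣representative∣≤ : ∀ {ρ} → (∀ i → ρ i ℕ.< P) → ∀ k → ∣ representative ρ k ∣ ≤ representative-bound k
  ∣representative∣≤ {ρ} ρ<P k = ≤-trans (∣∑∣≤∑∣∣ (λ i → ι (ℤ.+ ρ i) * L i k)) (∑-mono-≤ λ i →
    subst (_≤ ι (ℤ.+ P) * ∣ L i k ∣)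
          (sym (trans (∣p*q∣≡∣p∣*∣q∣ (ι (ℤ.+ ρ i)) (L i k)) (cong (_* ∣ L i k ∣) (∣ι∣ (ℤ.+ ρ i)))))
          (*-monoʳ-≤-nonNeg ∣ L i k ∣ {{∣-∣-nonNeg (L i k)}} (ι-mono-≤ (ℤ.+≤+ (ℕ.<⇒≤ (ρ<P i))))))

  carry-bound : ℚ → Fin m → ℕ
  carry-bound R k = ℤ.∣ ↥ (R + representative-bound k) ∣

  -- Each lattice vector is representative ρ + N w with ρ < P; in a box of radius R
  -- the vector w is then bounded as well.
  candidates : ℚ → List (Fin s → ℤ)
  candidates R = concatMap (λ ρ → map (coset ρ) (functions (λ k → integers-within (carry-bound R k))))
                           (functions (λ _ → upTo P))

  module _ {R y} (c : Fin s → ℤ) (y≋c : y ≋ ℤcomb L c) (∣y∣≤R : ∀ k → ∣ y k ∣ ≤ R) where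

    ∣carry∣≤ : ∀ k → ℤ.∣ carry c k ∣ ℕ.≤ carry-bound R k
    ∣carry∣≤ k = ℤ.drop‿+≤+ (ι-cancel-≤ (begin
      ι (ℤ.+ ℤ.∣ w ∣)                      ≡⟨ ∣ι∣ w ⟨
      ∣ ι w ∣                              ≡⟨ *-identityˡ ∣ ι w ∣ ⟨
      1ℚ * ∣ ι w ∣                         ≤⟨ *-monoʳ-≤-nonNeg ∣ ι w ∣ {{∣-∣-nonNeg (ι w)}} (1≤ι[1+n] (ℕ.pred N)) ⟩
      ιN * ∣ ι w ∣                         ≡⟨ cong (_* ∣ ι w ∣) (0≤p⇒∣p∣≡p (ι-nonNeg N)) ⟨
      ∣ ιN ∣ * ∣ ι w ∣                     ≡⟨ ∣p*q∣≡∣p∣*∣q∣ ιN (ι w) ⟨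
      ∣ ιN * ι w ∣                         ≡⟨ cong ∣_∣ Nw≡y-r ⟩
      ∣ y k - r ∣                          ≤⟨ ∣p-q∣≤∣p∣+∣q∣ (y k) r ⟩
      ∣ y k ∣ + ∣ r ∣                      ≤⟨ +-mono-≤ (∣y∣≤R k) (∣representative∣≤ (λ i → ℤ.n%ℕd<d (c i) P) k) ⟩
      R + representative-bound k           ≤⟨ p≤ι∣↥p∣ (R + representative-bound k) ⟩
      ι (ℤ.+ carry-bound R k) ∎))
      where
      open ≤-Reasoning
      w = carry c k
      r = representative (residue c) k
      r+x-r≡x : ∀ r x → (r + x) - r ≡ x
      r+x-r≡x = solve-∀ ℚ-ring
      Nw≡y-r : ιN * ι w ≡ y k - r
      Nw≡y-r = trans (sym (r+x-r≡x r (ιN * ι w))) (cong (_- r) (sym (trans (y≋c k) (ℤcomb-reduce c k))))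

    candidates-complete : Any (λ κ → y ≋ ℤcomb L κ) (candidates R)
    candidates-complete = Any.concatMap⁺ _ (Any.map in-coset
      (functions-complete (λ _ → upTo P) (λ i → ∈-upTo⁺ (ℤ.n%ℕd<d (c i) P))))
      where
      in-coset : ∀ {ρ} → ρ ≗ residue c →
        Any (λ κ → y ≋ ℤcomb L κ) (map (coset ρ) (functions (λ k → integers-within (carry-bound R k))))
      in-coset {ρ} ρ≗ = Any.map⁺ (Any.map y≋coset
        (functions-complete _ (λ k → integers-within-complete (∣carry∣≤ k))))
        where
        y≋coset : ∀ {w} → w ≗ carry c → y ≋ ℤcomb L (coset ρ w)
        y≋coset {w} w≗ k = begin
          y k
            ≡⟨ trans (y≋c k) (ℤcomb-reduce c k) ⟩
          representative (residue c) k + N-times (carry c) k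
            ≡⟨ cong₂ _+_ (ℤcomb-cong L (λ i → cong ℤ.+_ (sym (ρ≗ i))) k) (cong (λ z → ιN * ι z) (sym (w≗ k))) ⟩
          representative ρ k + N-times w k
            ≡⟨ ℤcomb-coset ρ w k ⟨
          ℤcomb L (coset ρ w) k ∎
          where open ≡-Reasoning

-- The trace form of a positive definite Hermitian form

module _ {n} (B : FDAlgebra n) where

  Tr-cong : ∀ {u v : Vec n} → u ≋ v → Tr B u ≡ Tr B v
  Tr-cong u≋v = ∑-cong (λ i → ∑-cong (λ j → cong (_* c B j i i) (u≋v j)))

  Tr-zero : ∀ {u : Vec n} → u ≋ 𝟎 → Tr B u ≡ 0ℚ
  Tr-zero u≋0 = ∑-zero (λ i → ∑-zero (λ j → trans (cong (_* c B j i i) (u≋0 j)) (*-zeroˡ (c B j i i))))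

  Tr-+ : ∀ u v → Tr B (u ⊕ v) ≡ Tr B u + Tr B v
  Tr-+ u v = trans
    (∑-cong (λ i → trans (∑-cong (λ j → *-distribʳ-+ (c B j i i) (u j) (v j)))
                         (∑-distrib-+ (λ j → u j * c B j i i) (λ j → v j * c B j i i))))
    (∑-distrib-+ (λ i → ∑ (λ j → u j * c B j i i)) (λ i → ∑ (λ j → v j * c B j i i)))

  Tr-⊙ : ∀ q u → Tr B (q ⊙ u) ≡ q * Tr B u
  Tr-⊙ q u = sym (trans (*-distribˡ-∑ q (λ i → ∑ (λ j → u j * c B j i i)))
    (∑-cong (λ i → trans (*-distribˡ-∑ q (λ j → u j * c B j i i))
                         (∑-cong (λ j → sym (*-assoc q (u j) (c B j i i)))))))

  Tr-∑ : ∀ {r} (F : Fin r → Vec n) → Tr B (λ k → ∑ (λ i → F i k)) ≡ ∑ (λ i → Tr B (F i))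
  Tr-∑ F = begin
    ∑ (λ a → ∑ (λ b → ∑ (λ i → F i b) * c B b a a))
      ≡⟨ ∑-cong (λ a → ∑-cong (λ b → *-distribʳ-∑ (c B b a a) (λ i → F i b))) ⟩
    ∑ (λ a → ∑ (λ b → ∑ (λ i → F i b * c B b a a)))
      ≡⟨ ∑-cong (λ a → ∑-comm (λ b i → F i b * c B b a a)) ⟩
    ∑ (λ a → ∑ (λ i → ∑ (λ b → F i b * c B b a a)))
      ≡⟨ ∑-comm (λ a i → ∑ (λ b → F i b * c B b a a)) ⟩
    ∑ (λ i → ∑ (λ a → ∑ (λ b → F i b * c B b a a))) ∎
    where open ≡-Reasoning

  -- Nothing forces a map Vec n → Vec n to respect ≋; positivity does so at 0:
  -- for d = star w we have star d ≋ w ≋ 0, hence Tr (d · star d) = 0.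
  involution-zero : ∀ {star} → IsPositiveInvolution B star → ∀ {w} → w ≋ 𝟎 → star w ≋ 𝟎
  involution-zero {star} ⋆ {w} w≋0 with dec-≋𝟎 (star w)
  ... | yes ⋆w≋0 = ⋆w≋0
  ... | no  ⋆w≢0 = ⊥-elim (<-irrefl (sym Tr[⋆w·⋆⋆w]≡0) (IsPositiveInvolution.positive ⋆ (star w) ⋆w≢0))
    where
    ⋆⋆w≋0 : star (star w) ≋ 𝟎
    ⋆⋆w≋0 k = trans (IsPositiveInvolution.involutive ⋆ w k) (w≋0 k)
    Tr[⋆w·⋆⋆w]≡0 : Tr B (mul B (star w) (star (star w))) ≡ 0ℚ
    Tr[⋆w·⋆⋆w]≡0 = Tr-zero (λ k → bilinear-zeroʳ (λ i j → c B i j k) (star w) ⋆⋆w≋0)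

module TraceForm {n m} (B : FDAlgebra n) {star} (⋆ : IsPositiveInvolution B star)
                 (V : LeftModule B m) (f : BilinearForm n m) (f-herm : IsPosDefHermitian B star V f) where

  open IsPosDefHermitian f-herm

  Q : Vec m → ℚ
  Q v = Tr B (app f v v)

  gram : Fin m → Fin m → ℚ
  gram i j = Tr B (h f i j)

  Q≡quadratic : ∀ v → Q v ≡ quadratic gram v
  Q≡quadratic v = trans (Tr-∑ B (λ i k → ∑ (λ j → (v i * v j) * h f i j k)))
    (∑-cong (λ i → trans (Tr-∑ B (λ j k → (v i * v j) * h f i j k))
                         (∑-cong (λ j → Tr-⊙ B (v i * v j) (h f i j)))))

  gram-positiveDefinite : PositiveDefinite gram
  gram-positiveDefinite v v≢0 = subst (0ℚ <_) (Q≡quadratic v) (pos-def v v≢0)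

  app-cong : ∀ {y y′ z z′ : Vec m} → y ≋ y′ → z ≋ z′ → app f y z ≋ app f y′ z′
  app-cong y≋y′ z≋z′ k = bilinear-cong (λ i j → h f i j k) y≋y′ z≋z′

  Q-cong : ∀ {u v} → u ≋ v → Q u ≡ Q v
  Q-cong u≋v = Tr-cong B (app-cong u≋v u≋v)

  -- f (z , y) = f (y , z)* vanishes together with f (y , z).
  Q-orthogonal : ∀ {x y z} → x ≋ (y ⊕ z) → app f y z ≋ 𝟎 → Q x ≡ Q y + Q z
  Q-orthogonal {x} {y} {z} x≋y+z f[y,z]≋0 = begin
    Q x                                   ≡⟨ Q-cong x≋y+z ⟩
    Tr B (app f (y ⊕ z) (y ⊕ z))          ≡⟨ Tr-cong B diagonal ⟩
    Tr B (app f y y ⊕ app f z z)          ≡⟨ Tr-+ B (app f y y) (app f z z) ⟩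
    Q y + Q z ∎
    where
    open ≡-Reasoning
    f[z,y]≋0 : app f z y ≋ 𝟎
    f[z,y]≋0 k = trans (hermitian y z k) (involution-zero B ⋆ f[y,z]≋0 k)
    drop-zeros : ∀ a b → (a + 0ℚ) + (0ℚ + b) ≡ a + b
    drop-zeros = solve-∀ ℚ-ring
    diagonal : app f (y ⊕ z) (y ⊕ z) ≋ (app f y y ⊕ app f z z)
    diagonal k = trans (quadratic-+ (λ i j → h f i j k) y z)
      (trans (cong₂ (λ u v → (app f y y k + u) + (v + app f z z k)) (f[y,z]≋0 k) (f[z,y]≋0 k))
             (drop-zeros (app f y y k) (app f z z k)))

  Q-orthogonal-< : ∀ {x y z} → x ≋ (y ⊕ z) → app f y z ≋ 𝟎 → NonZero y → NonZero z →
                   Q y < Q x × Q z < Q x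
  Q-orthogonal-< {x} {y} {z} x≋y+z f[y,z]≋0 y≢0 z≢0 =
    <-of-+ˡ Qx≡ (pos-def z z≢0) , <-of-+ˡ (trans Qx≡ (+-comm (Q y) (Q z))) (pos-def y y≢0)
    where
    Qx≡ : Q x ≡ Q y + Q z
    Qx≡ = Q-orthogonal {x} {y} {z} x≋y+z f[y,z]≋0

-- Decomposition into primitive elements

sumV-++ : ∀ {m} (xs ys : List (Vec m)) → sumV (xs ++ ys) ≋ (sumV xs ⊕ sumV ys)
sumV-++ []       ys k = sym (+-identityˡ (sumV ys k))
sumV-++ (x ∷ xs) ys k = trans (cong (x k +_) (sumV-++ xs ys k)) (sym (+-assoc (x k) (sumV xs k) (sumV ys k)))

module Decomposition {n m s} (B : FDAlgebra n) {star} (⋆ : IsPositiveInvolution B star)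
                     (V : LeftModule B m) (f : BilinearForm n m) (f-herm : IsPosDefHermitian B star V f)
                     (L : Fin s → Vec m) (spans : SpansQ L) where

  open TraceForm B ⋆ V f f-herm
  open Lattice L spans

  Decomposition : Vec m → Set
  Decomposition x = Σ (List (Vec m)) λ ps → All (Primitive f L) ps × (x ≋ sumV ps)

  SplitAt : Vec m → (Fin s → ℤ) → Set
  SplitAt x κ = NonZero y × NonZero (x ⊖ y) × (app f y (x ⊖ y) ≋ 𝟎)
    where y = ℤcomb L κ

  splitAt? : ∀ x κ → Dec (SplitAt x κ)
  splitAt? x κ = ¬? (dec-≋𝟎 (ℤcomb L κ)) ×-dec ¬? (dec-≋𝟎 (x ⊖ ℤcomb L κ))
                 ×-dec Fin.all? (λ k → app f (ℤcomb L κ) (x ⊖ ℤcomb L κ) k ≟ 0ℚ)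

  x≋y⊕[x⊖y] : ∀ (x y : Vec m) → x ≋ (y ⊕ (x ⊖ y))
  x≋y⊕[x⊖y] x y k = split (x k) (y k)
    where
    split : ∀ x y → x ≡ y + (x - y)
    split = solve-∀ ℚ-ring

  -- Lattice vectors with Q ≤ T are among finitely many listed candidates, which makes
  -- both primitivity and the descent below decidable.
  module BelowLevel (T : ℚ) where

    splits : List (Fin s → ℤ)
    splits = candidates (proj₁ (sublevel-bounded gram gram-positiveDefinite T))

    values : List ℚ
    values = map (λ κ → Q (ℤcomb L κ)) splits

    splits-complete : ∀ {y} → InZSpan L y → Q y ≤ T → Any (λ κ → y ≋ ℤcomb L κ) splits
    splits-complete {y} (c , y≋c) Qy≤T = candidates-complete c y≋c
      (proj₂ (sublevel-bounded gram gram-positiveDefinite T) y (subst (_≤ T) (Q≡quadratic y) Qy≤T))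

    values-complete : ∀ {y} → InZSpan L y → Q y ≤ T → Q y ∈ values
    values-complete y∈L Qy≤T = Any.map⁺ (Any.map Q-cong (splits-complete y∈L Qy≤T))

    primitive-if-unsplit : ∀ {x} → InZSpan L x → NonZero x → Q x ≤ T → ¬ Any (SplitAt x) splits →
                           Primitive f L x
    primitive-if-unsplit {x} x∈L x≢0 Qx≤T unsplit = x∈L , x≢0 , λ y z y∈L _ x≋y+z f[y,z]≋0 →
      trivial y z y∈L x≋y+z f[y,z]≋0 (dec-≋𝟎 y) (dec-≋𝟎 z)
      where
      trivial : ∀ y z → InZSpan L y → x ≋ (y ⊕ z) → app f y z ≋ 𝟎 →
                Dec (y ≋ 𝟎) → Dec (z ≋ 𝟎) → (y ≋ 𝟎) ⊎ (z ≋ 𝟎)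
      trivial _ _ _ _ _ (yes y≋0) _         = inj₁ y≋0
      trivial _ _ _ _ _ (no _)    (yes z≋0) = inj₂ z≋0
      trivial y z y∈L x≋y+z f[y,z]≋0 (no y≢0) (no z≢0) =
        ⊥-elim (unsplit (Any.map (λ {κ} → splitAt {κ}) (splits-complete y∈L Qy≤T)))
        where
        Qy≤T : Q y ≤ T
        Qy≤T = ≤-trans (<⇒≤ (proj₁ (Q-orthogonal-< {x} {y} {z} x≋y+z f[y,z]≋0 y≢0 z≢0))) Qx≤T
        cancel : ∀ a b → (a + b) - a ≡ b
        cancel = solve-∀ ℚ-ring
        splitAt : ∀ {κ} → y ≋ ℤcomb L κ → SplitAt x κ
        splitAt {κ} y≋κ = (λ κ≋0 → y≢0 (λ k → trans (y≋κ k) (κ≋0 k)))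
                        , (λ r≋0 → z≢0 (λ k → trans (z≋r k) (r≋0 k)))
                        , (λ k → trans (sym (app-cong y≋κ z≋r k)) (f[y,z]≋0 k))
          where
          z≋r : z ≋ (x ⊖ ℤcomb L κ)
          z≋r k = sym (trans (cong₂ _-_ (x≋y+z k) (sym (y≋κ k))) (cancel (y k) (z k)))

    -- The fuel bounds the number of listed values below Q x, which drops strictly
    -- when an orthogonal summand is split off.
    decompose : ∀ fuel {x} → InZSpan L x → NonZero x → Q x ≤ T →
                countBelow (Q x) values ℕ.< fuel → Decomposition x
    decompose (suc fuel) {x} x∈L x≢0 Qx≤T count<fuel = by-cases (any? (splitAt? x) splits)
      where
      descend : ∀ {v} → InZSpan L v → NonZero v → Q v < Q x → Decomposition v
      descend v∈L v≢0 Qv<Qx = decompose fuel v∈L v≢0 Qv≤T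
        (ℕ.<-≤-trans (countBelow-mono-< Qv<Qx (values-complete v∈L Qv≤T)) (ℕ.≤-pred count<fuel))
        where
        Qv≤T = ≤-trans (<⇒≤ Qv<Qx) Qx≤T
      recombine : Σ (Fin s → ℤ) (SplitAt x) → Decomposition x
      recombine (κ , y≢0 , z≢0 , f[y,z]≋0) =
        proj₁ dy ++ proj₁ dz , All.++⁺ (proj₁ (proj₂ dy)) (proj₁ (proj₂ dz)) , x≋sum
        where
        y = ℤcomb L κ
        z = x ⊖ y
        x≋y+z : x ≋ (y ⊕ z)
        x≋y+z = x≋y⊕[x⊖y] x y
        Q< = Q-orthogonal-< {x} {y} {z} x≋y+z f[y,z]≋0 y≢0 z≢0
        dy : Decomposition y
        dy = descend (κ , λ _ → refl) y≢0 (proj₁ Q<)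
        dz : Decomposition z
        dz = descend (InZSpan-⊖ L x∈L (κ , λ _ → refl)) z≢0 (proj₂ Q<)
        x≋sum : x ≋ sumV (proj₁ dy ++ proj₁ dz)
        x≋sum k = trans (x≋y+z k) (trans (cong₂ _+_ (proj₂ (proj₂ dy) k) (proj₂ (proj₂ dz) k))
                                         (sym (sumV-++ (proj₁ dy) (proj₁ dz) k)))
      by-cases : Dec (Any (SplitAt x) splits) → Decomposition x
      by-cases (no unsplit) = [ x ] , primitive-if-unsplit x∈L x≢0 Qx≤T unsplit ∷ [] , λ k → sym (+-identityʳ (x k))
      by-cases (yes split)  = recombine (Any.satisfied split)

lemma3p2 : ∀ {n m r s : ℕ}
    (B : FDAlgebra n) (star : Vec n → Vec n) → IsPositiveInvolution B star →
    (O : Fin r → Vec n) → IsOrder B O →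
    (V : LeftModule B m) → Faithful V →
    (f : BilinearForm n m) → IsPosDefHermitian B star V f →
    (L : Fin s → Vec m) → IsOLattice B V O L →
    ∀ (x : Vec m) → InZSpan L x → NonZero x →
    Σ (List (Vec m)) λ ps → All (Primitive f L) ps × (x ≋ sumV ps)
lemma3p2 B _ ⋆ _ _ V _ f f-herm L L-lattice x x∈L x≢0 =
  decompose (suc (countBelow (Q x) values)) x∈L x≢0 ≤-refl ℕ.≤-refl
  where
  open Decomposition B ⋆ V f f-herm L (IsOLattice.spans L-lattice)
  open TraceForm B ⋆ V f f-herm using (Q)
  open BelowLevel (Q x)
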